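{- Let $\mathsf{L}$ be a description logic, $\mathcal{T}$ a TBox, and $(\mathcal{T}_u,\mathcal{T}_g)$ a correct absorption of $\mathcal{T}$. Then for every concept $C\in\mathsf{L}$, $C$ has a witness that is admissible with respect to $\mathcal{T}$ if and only if $C$ has a witness that is unfolded with respect to $(\mathcal{T}_u,\mathcal{T}_g)$.
   Context: A description logic (DL) $\mathsf{L}$ is based on infinite sets $\mathsf{NC}$ of atomic concepts and $\mathsf{NR}$ of atomic roles; $\mathsf{L}$ is identified with its set of well-formed concepts, closed under boolean operations ($\sqcap,\sqcup,\neg$) and sub-concepts. $C\rightarrow D$ abbreviates $\neg C\sqcup D$, $C\leftrightarrow D$ abbreviates $(C\rightarrow D)\sqcap(D\rightarrow C)$. An interpretation is $\mathcal{I}=(\Delta^{\mathcal{I}},\cdot^{\mathcal{I}})$ with $\Delta^{\mathcal{I}}$ non-empty, $\cdot^{\mathcal{I}}$ mapping $\mathsf{NC}$ to $2^{\Delta^{\mathcal{I}}}$ and $\mathsf{NR}$ to $2^{\Delta^{\mathcal{I}}\times\Delta^{\mathcal{I}}}$. A set $\mathsf{Int}(\mathsf{L})$ of admissible interpretations is given, closed under isomorphism, such that for two interpretations agreeing on $\mathsf{NR}$, one is in $\mathsf{Int}(\mathsf{L})$ iff the other is. Every $\mathcal{I}\in\mathsf{Int}(\mathsf{L})$ extends to all concepts so that (I1) boolean combinations are interpreted set-theoretically, and (I2) $C^{\mathcal{I}}$ depends only on the interpretations of atomic concepts and roles occurring syntactically in $C$. A TBox is a finite set of axioms $C_1\sqsubseteq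 C_2$ or $C_1\doteq C_2$; $\mathcal{I}\in\mathsf{Int}(\mathsf{L})$ is a model ($\mathcal{I}\models\mathcal{T}$) iff $C_1^{\mathcal{I}}\subseteq C_2^{\mathcal{I}}$ (resp. $=$) for each axiom. TBoxes $\mathcal{T},\mathcal{T}'$ are equivalent ($\mathcal{T}\equiv\mathcal{T}'$) iff they have the same models in $\mathsf{Int}(\mathsf{L})$. A witness for $C$ is $\mathcal{W}=(\Delta^{\mathcal{W}},\cdot^{\mathcal{W}},\mathcal{L}^{\mathcal{W}})$ with $\Delta^{\mathcal{W}}$ non-empty, $\cdot^{\mathcal{W}}$ mapping $\mathsf{NR}$ to binary relations on $\Delta^{\mathcal{W}}$, $\mathcal{L}^{\mathcal{W}}:\Delta^{\mathcal{W}}\to2^{\mathsf{L}}$, such that (W1) some $x$ has $C\in\mathcal{L}^{\mathcal{W}}(x)$; (W2) some $\mathcal{I}\in\mathsf{Int}(\mathsf{L})$ stems from $\mathcal{W}$; (W3) every $\mathcal{I}\in\mathsf{Int}(\mathsf{L})$ stemming from $\mathcal{W}$ satisfies $D\in\mathcal{L}^{\mathcal{W}}(x)\Rightarrow x\in D^{\mathcal{I}}$. $\mathcal{I}$ stems from $\mathcal{W}$ if $\Delta^{\mathcal{I}}=\Delta^{\mathcal{W}}$, $\cdot^{\mathcal{I}}|_{\mathsf{NR}}=\cdot^{\mathcal{W}}$, and for all $A\in\mathsf{NC}$: $A\in\mathcal{L}^{\mathcal{W}}(x)\Rightarrow x\in A^{\mathcal{I}}$, $\neg A\in\mathcal{L}^{\mathcal{W}}(x)\Rightarrow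 x\notin A^{\mathcal{I}}$. $\mathcal{W}$ is admissible w.r.t. $\mathcal{T}$ if some $\mathcal{I}\in\mathsf{Int}(\mathsf{L})$ stemming from $\mathcal{W}$ satisfies $\mathcal{I}\models\mathcal{T}$. An absorption of $\mathcal{T}$ is a pair of TBoxes $(\mathcal{T}_u,\mathcal{T}_g)$ with $\mathcal{T}\equiv\mathcal{T}_u\cup\mathcal{T}_g$ where $\mathcal{T}_u$ contains only axioms $A\sqsubseteq D$ or $\neg A\sqsubseteq D$ with $A\in\mathsf{NC}$. A witness $\mathcal{W}$ is unfolded w.r.t. $(\mathcal{T}_u,\mathcal{T}_g)$ if for every $x\in\Delta^{\mathcal{W}}$: $A\sqsubseteq D\in\mathcal{T}_u$ and $A\in\mathcal{L}^{\mathcal{W}}(x)$ imply $D\in\mathcal{L}^{\mathcal{W}}(x)$; $\neg A\sqsubseteq D\in\mathcal{T}_u$ and $\neg A\in\mathcal{L}^{\mathcal{W}}(x)$ imply $D\in\mathcal{L}^{\mathcal{W}}(x)$; $C_1\sqsubseteq C_2\in\mathcal{T}_g$ implies $C_1\rightarrow C_2\in\mathcal{L}^{\mathcal{W}}(x)$; $C_1\doteq C_2\in\mathcal{T}_g$ implies $C_1\leftrightarrow C_2\in\mathcal{L}^{\mathcal{W}}(x)$. The absorption is correct if every witness (for any concept) that is unfolded w.r.t. $(\mathcal{T}_u,\mathcal{T}_g)$ is admissible w.r.t. $\mathcal{T}$. -}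

module Defs where

open import Level using (Level)
open import Data.Nat using (ℕ)
open import Data.Bool using (Bool; true; false; _∧_; _∨_; not)
open import Data.Fin using (Fin)
open import Data.Product using (Σ; _×_; ∃)
open import Data.Sum using (_⊎_)
open import Data.List using (List; _++_)
open import Data.List.Membership.Propositional using (_∈_)
open import Data.List.Relation.Unary.All using (All)
open import Relation.Nullary using (¬_)
open import Relation.Binary.PropositionalEquality using (_≡_)
open import Function.Bundles using (_⇔_; _↔_; Inverse)
open import Function.Definitions using (Injective)

-- Atomic concepts NC, atomic roles NR, and a set Op of further concept
-- constructors (e.g. ∃r., ∀r., ≥n r., ⊤, ...), each with an arity; the
-- roles occurring in an operator symbol are given by opRoles.

module Syntax (NC NR Op : Set) (arity : Op → ℕ) (opRoles : Op → NR → Set) where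

  infixr 7 _⊓_
  infixr 6 _⊔_

  data Concept : Set where
    atom : NC → Concept
    _⊓_  : Concept → Concept → Concept
    _⊔_  : Concept → Concept → Concept
    ¬c_  : Concept → Concept
    op   : (o : Op) → (Fin (arity o) → Concept) → Concept

  _⇒c_ : Concept → Concept → Concept
  C ⇒c D = (¬c C) ⊔ D

  _⇔c_ : Concept → Concept → Concept
  C ⇔c D = (C ⇒c D) ⊓ (D ⇒c C)

  data OccC (A : NC) : Concept → Set where
    here  : OccC A (atom A)
    ⊓ˡ    : ∀ {C D} → OccC A C → OccC A (C ⊓ D)
    ⊓ʳ    : ∀ {C D} → OccC A D → OccC A (C ⊓ D)
    ⊔ˡ    : ∀ {C D} → OccC A C → OccC A (C ⊔ D)
    ⊔ʳ    : ∀ {C D} → OccC A D → OccC A (C ⊔ D)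
    ¬o    : ∀ {C} → OccC A C → OccC A (¬c C)
    arg   : ∀ {o cs} (i : Fin (arity o)) → OccC A (cs i) → OccC A (op o cs)

  data OccR (r : NR) : Concept → Set where
    inOp  : ∀ {o cs} → opRoles o r → OccR r (op o cs)
    ⊓ˡ    : ∀ {C D} → OccR r C → OccR r (C ⊓ D)
    ⊓ʳ    : ∀ {C D} → OccR r D → OccR r (C ⊓ D)
    ⊔ˡ    : ∀ {C D} → OccR r C → OccR r (C ⊔ D)
    ⊔ʳ    : ∀ {C D} → OccR r D → OccR r (C ⊔ D)
    ¬o    : ∀ {C} → OccR r C → OccR r (¬c C)
    arg   : ∀ {o cs} (i : Fin (arity o)) → OccR r (cs i) → OccR r (op o cs)

  -- Interpretations over a given domain Δ (Δ non-empty: a chosen element)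
  record Interp (Δ : Set) : Set₁ where
    field
      elem : Δ
      conc : NC → Δ → Bool
      role : NR → Δ → Δ → Bool

  open Interp public

  data Axiom : Set where
    _⊑_ : Concept → Concept → Axiom
    _≐_ : Concept → Concept → Axiom

  TBox : Set
  TBox = List Axiom

Injective-≡ : ∀ {A B : Set} → (A → B) → Set
Injective-≡ f = Injective _≡_ _≡_ f

record DL : Set₂ where
  field
    NC NR Op : Set
    arity    : Op → ℕ
    opRoles  : Op → NR → Set
    NC-inf   : Σ (ℕ → NC) Injective-≡
    NR-inf   : Σ (ℕ → NR) Injective-≡

  open Syntax NC NR Op arity opRoles public

  field
    -- the well-formed concepts of L: closed under boolean ops and sub-concepts
    WF       : Concept → Set
    WF-atom  : ∀ A → WF (atom A)
    WF-⊓     : ∀ {C D} → WF C → WF D → WF (C ⊓ D)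
    WF-⊔     : ∀ {C D} → WF C → WF D → WF (C ⊔ D)
    WF-¬     : ∀ {C} → WF C → WF (¬c C)
    WF-⊓⁻    : ∀ {C D} → WF (C ⊓ D) → WF C × WF D
    WF-⊔⁻    : ∀ {C D} → WF (C ⊔ D) → WF C × WF D
    WF-¬⁻    : ∀ {C} → WF (¬c C) → WF C
    WF-op⁻   : ∀ {o cs} → WF (op o cs) → ∀ i → WF (cs i)

    Adm      : (Δ : Set) → Interp Δ → Set
    Adm-iso  : ∀ {Δ Δ'} (I : Interp Δ) (J : Interp Δ') (f : Δ ↔ Δ') →
               (∀ A x → conc I A x ≡ conc J A (Inverse.to f x)) →
               (∀ r x y → role I r x y ≡ role J r (Inverse.to f x) (Inverse.to f y)) →
               Adm Δ I → Adm Δ' J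
    Adm-roles : ∀ {Δ} (I J : Interp Δ) →
               (∀ r x y → role I r x y ≡ role J r x y) →
               Adm Δ I → Adm Δ J

    ext      : ∀ {Δ} → Interp Δ → Concept → Δ → Bool
    ext-atom : ∀ {Δ} (I : Interp Δ) → Adm Δ I → ∀ A x → ext I (atom A) x ≡ conc I A x
    ext-⊓    : ∀ {Δ} (I : Interp Δ) → Adm Δ I → ∀ C D x → ext I (C ⊓ D) x ≡ (ext I C x ∧ ext I D x)
    ext-⊔    : ∀ {Δ} (I : Interp Δ) → Adm Δ I → ∀ C D x → ext I (C ⊔ D) x ≡ (ext I C x ∨ ext I D x)
    ext-¬    : ∀ {Δ} (I : Interp Δ) → Adm Δ I → ∀ C x → ext I (¬c C) x ≡ not (ext I C x)
    ext-loc  : ∀ {Δ} (I J : Interp Δ) → Adm Δ I → Adm Δ J → ∀ C →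
               (∀ A → OccC A C → ∀ x → conc I A x ≡ conc J A x) →
               (∀ r → OccR r C → ∀ x y → role I r x y ≡ role J r x y) →
               ∀ x → ext I C x ≡ ext J C x

module Semantics (L : DL) where
  open DL L public

  WF-Ax : Axiom → Set
  WF-Ax (C ⊑ D) = WF C × WF D
  WF-Ax (C ≐ D) = WF C × WF D

  WF-TBox : TBox → Set
  WF-TBox T = All WF-Ax T

  SatAx : ∀ {Δ} → Interp Δ → Axiom → Set
  SatAx I (C ⊑ D) = ∀ x → ext I C x ≡ true → ext I D x ≡ true
  SatAx I (C ≐ D) = ∀ x → ext I C x ≡ ext I D x

  _⊨_ : ∀ {Δ} → Interp Δ → TBox → Set
  _⊨_ {Δ} I T = Adm Δ I × (∀ ax → ax ∈ T → SatAx I ax)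

  _≡T_ : TBox → TBox → Set₁
  T ≡T T' = ∀ (Δ : Set) (I : Interp Δ) → (I ⊨ T) ⇔ (I ⊨ T')

  record PreWitness : Set₁ where
    field
      Δ     : Set
      wrole : NR → Δ → Δ → Bool
      label : Δ → Concept → Set
      label-WF : ∀ x D → label x D → WF D

  open PreWitness public

  StemsFrom : (W : PreWitness) → Interp (Δ W) → Set
  StemsFrom W I =
    (∀ r x y → role I r x y ≡ wrole W r x y) ×
    (∀ A x → label W x (atom A) → conc I A x ≡ true) ×
    (∀ A x → label W x (¬c atom A) → conc I A x ≡ false)

  IsWitness : Concept → PreWitness → Set₁
  IsWitness C W =
    (Σ (Δ W) λ x → label W x C) ×
    (Σ (Interp (Δ W)) λ I → StemsFrom W I × Adm (Δ W) I) ×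
    (∀ (I : Interp (Δ W)) → StemsFrom W I → Adm (Δ W) I →
       ∀ x D → label W x D → ext I D x ≡ true)

  AdmissibleW : PreWitness → TBox → Set₁
  AdmissibleW W T = Σ (Interp (Δ W)) λ I → StemsFrom W I × (I ⊨ T)

  UnaryAx : Axiom → Set
  UnaryAx ax = ∃ λ A → ∃ λ D → (ax ≡ (atom A ⊑ D)) ⊎ (ax ≡ ((¬c atom A) ⊑ D))

  record Absorption (T : TBox) : Set₁ where
    field
      Tu Tg    : TBox
      Tu-WF    : WF-TBox Tu
      Tg-WF    : WF-TBox Tg
      Tu-shape : All UnaryAx Tu
      equiv    : T ≡T (Tu ++ Tg)

  Unfolded : PreWitness → TBox → TBox → Set
  Unfolded W Tu Tg = ∀ (x : Δ W) →
    (∀ A D → (atom A ⊑ D) ∈ Tu → label W x (atom A) → label W x D) ×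
    (∀ A D → ((¬c atom A) ⊑ D) ∈ Tu → label W x (¬c atom A) → label W x D) ×
    (∀ C₁ C₂ → (C₁ ⊑ C₂) ∈ Tg → label W x (C₁ ⇒c C₂)) ×
    (∀ C₁ C₂ → (C₁ ≐ C₂) ∈ Tg → label W x (C₁ ⇔c C₂))

  CorrectAbsorption : ∀ {T} → Absorption T → Set₁
  CorrectAbsorption {T} ab = ∀ (C : Concept) (W : PreWitness) → IsWitness C W →
    Unfolded W (Absorption.Tu ab) (Absorption.Tg ab) → AdmissibleW W T

{-# OPTIONS --safe #-}
-- A model I of T with x ∈ C^I yields the witness labelling each element x
-- with all well-formed concepts true at x in I. Every admissible J stemming
-- from it agrees with I on atoms (each atom or its negation is in the label)
-- and on roles, so by locality (I2) J satisfies the labels, and it is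
-- unfolded because I is a model of T_u ∪ T_g. Conversely, correctness of the
-- absorption makes every unfolded witness admissible.
module Submission where

open import Defs
open import Data.Bool using (true; false; _∧_; _∨_; not)
open import Data.Product using (Σ; _×_; _,_; proj₁; proj₂)
open import Data.List using (_++_)
open import Data.List.Membership.Propositional using (_∈_)
open import Data.List.Membership.Propositional.Properties using (∈-++⁺ˡ; ∈-++⁺ʳ)
open import Data.List.Relation.Unary.All as All using ()
open import Function.Bundles using (_⇔_; mk⇔; Equivalence)
open import Relation.Binary.PropositionalEquality
  using (_≡_; refl; sym; trans; cong)
open Relation.Binary.PropositionalEquality.≡-Reasoning

not-∨-true : ∀ a b → (a ≡ true → b ≡ true) → not a ∨ b ≡ true
not-∨-true false b a⇒b = refl
not-∨-true true  b a⇒b = a⇒b refl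

∧-true : ∀ {a b} → a ≡ true → b ≡ true → a ∧ b ≡ true
∧-true refl refl = refl

not-true⇒false : ∀ {a} → not a ≡ true → a ≡ false
not-true⇒false {false} _ = refl

module _ (L : DL) where
  open Semantics L

  module _ {Δ : Set} (I : Interp Δ) (adm : Adm Δ I) where

    ext-⇒c-true : ∀ C₁ C₂ x → (ext I C₁ x ≡ true → ext I C₂ x ≡ true) →
                  ext I (C₁ ⇒c C₂) x ≡ true
    ext-⇒c-true C₁ C₂ x C₁⇒C₂ = begin
      ext I (¬c C₁ ⊔ C₂) x          ≡⟨ ext-⊔ I adm (¬c C₁) C₂ x ⟩
      ext I (¬c C₁) x ∨ ext I C₂ x  ≡⟨ cong (_∨ ext I C₂ x) (ext-¬ I adm C₁ x) ⟩
      not (ext I C₁ x) ∨ ext I C₂ x ≡⟨ not-∨-true _ _ C₁⇒C₂ ⟩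
      true                          ∎

    ext-⇔c-true : ∀ C₁ C₂ x → ext I C₁ x ≡ ext I C₂ x → ext I (C₁ ⇔c C₂) x ≡ true
    ext-⇔c-true C₁ C₂ x C₁≡C₂ = trans (ext-⊓ I adm (C₁ ⇒c C₂) (C₂ ⇒c C₁) x)
      (∧-true (ext-⇒c-true C₁ C₂ x (trans (sym C₁≡C₂)))
              (ext-⇒c-true C₂ C₁ x (trans C₁≡C₂)))

    ext-¬atom-true : ∀ A x → ext I (¬c atom A) x ≡ true → conc I A x ≡ false
    ext-¬atom-true A x ¬A-true = not-true⇒false (begin
      not (conc I A x)        ≡⟨ cong not (ext-atom I adm A x) ⟨
      not (ext I (atom A) x)  ≡⟨ ext-¬ I adm (atom A) x ⟨
      ext I (¬c atom A) x     ≡⟨ ¬A-true ⟩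
      true                    ∎)

  theoryWitness : ∀ {Δ} → Interp Δ → PreWitness
  theoryWitness {Δ} I = record
    { Δ        = Δ
    ; wrole    = role I
    ; label    = λ x D → WF D × ext I D x ≡ true
    ; label-WF = λ _ _ → proj₁
    }

  module _ {Δ : Set} (I : Interp Δ) (adm : Adm Δ I) where

    theoryWitness-stems : StemsFrom (theoryWitness I) I
    theoryWitness-stems =
        (λ _ _ _ → refl)
      , (λ A x (_ , A-true) → trans (sym (ext-atom I adm A x)) A-true)
      , (λ A x (_ , ¬A-true) → ext-¬atom-true I adm A x ¬A-true)

    stems-from-theoryWitness⇒conc-≡ : ∀ J → StemsFrom (theoryWitness I) J →
                                       ∀ A x → conc J A x ≡ conc I A x
    stems-from-theoryWitness⇒conc-≡ J (_ , atoms , negAtoms) A x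
      with conc I A x in A-val
    ... | true  = atoms A x (WF-atom A , trans (ext-atom I adm A x) A-val)
    ... | false = negAtoms A x (WF-¬ (WF-atom A) , (begin
      ext I (¬c atom A) x     ≡⟨ ext-¬ I adm (atom A) x ⟩
      not (ext I (atom A) x)  ≡⟨ cong not (trans (ext-atom I adm A x) A-val) ⟩
      true                    ∎))

    stems-from-theoryWitness⇒ext-≡ : ∀ J → StemsFrom (theoryWitness I) J → Adm Δ J →
                                      ∀ D x → ext J D x ≡ ext I D x
    stems-from-theoryWitness⇒ext-≡ J stems admJ D =
      ext-loc J I admJ adm D
        (λ A _ → stems-from-theoryWitness⇒conc-≡ J stems A)
        (λ r _ → proj₁ stems r)

    theoryWitness-isWitness : ∀ {C x} → WF C → ext I C x ≡ true →
                              IsWitness C (theoryWitness I)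
    theoryWitness-isWitness {x = x} wfC C-true =
        (x , wfC , C-true)
      , (I , theoryWitness-stems , adm)
      , λ J stems admJ y D (_ , D-true) →
          trans (stems-from-theoryWitness⇒ext-≡ J stems admJ D y) D-true

    theoryWitness-unfolded : ∀ {Tu Tg} → WF-TBox Tu → WF-TBox Tg →
                             (∀ ax → ax ∈ (Tu ++ Tg) → SatAx I ax) →
                             Unfolded (theoryWitness I) Tu Tg
    theoryWitness-unfolded {Tu} wfTu wfTg sat x =
        (λ _ _ ax∈Tu (_ , lhs) →
           proj₂ (All.lookup wfTu ax∈Tu) , sat _ (∈-++⁺ˡ ax∈Tu) x lhs)
      , (λ _ _ ax∈Tu (_ , lhs) →
           proj₂ (All.lookup wfTu ax∈Tu) , sat _ (∈-++⁺ˡ ax∈Tu) x lhs)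
      , (λ C₁ C₂ ax∈Tg → let wf₁ , wf₂ = All.lookup wfTg ax∈Tg in
           WF-⊔ (WF-¬ wf₁) wf₂ ,
           ext-⇒c-true I adm C₁ C₂ x (sat _ (∈-++⁺ʳ Tu ax∈Tg) x))
      , (λ C₁ C₂ ax∈Tg → let wf₁ , wf₂ = All.lookup wfTg ax∈Tg in
           WF-⊓ (WF-⊔ (WF-¬ wf₁) wf₂) (WF-⊔ (WF-¬ wf₂) wf₁) ,
           ext-⇔c-true I adm C₁ C₂ x (sat _ (∈-++⁺ʳ Tu ax∈Tg) x))

mainTheorem4 : (L : DL) → let open Semantics L in
    (T : TBox) → WF-TBox T → (ab : Absorption T) → CorrectAbsorption ab →
    (C : Concept) → WF C →
    (Σ PreWitness λ W → IsWitness C W × AdmissibleW W T) ⇔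
    (Σ PreWitness λ W → IsWitness C W × Unfolded W (Absorption.Tu ab) (Absorption.Tg ab))
mainTheorem4 L T _ ab correct C wfC = mk⇔ admissible⇒unfolded unfolded⇒admissible
  where
  open Semantics L
  open Absorption ab

  admissible⇒unfolded : Σ PreWitness (λ W → IsWitness C W × AdmissibleW W T) →
                        Σ PreWitness (λ W → IsWitness C W × Unfolded W Tu Tg)
  admissible⇒unfolded (W , ((x , C∈x) , _ , satisfied) , I , stems , adm , model) =
      theoryWitness L I
    , theoryWitness-isWitness L I adm wfC (satisfied I stems adm x C C∈x)
    , theoryWitness-unfolded L I adm Tu-WF Tg-WF
        (proj₂ (Equivalence.to (equiv (Δ W) I) (adm , model)))

  unfolded⇒admissible : Σ PreWitness (λ W → IsWitness C W × Unfolded W Tu Tg) →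
                        Σ PreWitness (λ W → IsWitness C W × AdmissibleW W T)
  unfolded⇒admissible (W , isW , unfolded) = W , isW , correct C W isW unfolded
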